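{- Let $\mathscr{L}$ be a set and $\mathfrak{S}=(\mathbf{M},\models_1,\models_2,S_q,\mathcal{P}(\mathscr{L}))$ a strongly granular semantics for $\mathscr{L}$ with $S_q=\{(\models_1,\models_2)\}$ and $\models_2\subseteq\models_1$. Then $W_{\mathfrak{S}}$ is a $q$-consequence operator.
   Context: Here $\mathbf{M}$ is a set and $\models_1,\models_2\subseteq\mathbf{M}\times\mathcal{P}(\mathscr{L})$. $W_{\mathfrak{S}}$ is defined by: $\alpha\in W_{\mathfrak{S}}(\Gamma)$ iff for all $m\in\mathbf{M}$, $m\models_1\Gamma$ implies $m\models_2\{\alpha\}$. The semantics is strongly granular if for each $i\in\{1,2\}$, all $m\in\mathbf{M}$, $\Gamma\subseteq\mathscr{L}$: $m\models_i\Gamma$ iff $m\models_i\{\alpha\}$ for all $\alpha\in\Gamma$. A map $W:\mathcal{P}(\mathscr{L})\to\mathcal{P}(\mathscr{L})$ is a $q$-consequence operator if $\Gamma\subseteq\Sigma$ implies $W(\Gamma)\subseteq W(\Sigma)$ and $W(W(\Gamma)\cup\Gamma)=W(\Gamma)$ for all $\Gamma$. -}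

module Defs where

open import Level using (0ℓ; suc)
open import Data.Product using (_×_)
open import Relation.Unary using (Pred; _⊆_; _≐_; _∪_; ｛_｝)

Subset : Set → Set₁
Subset L = Pred L 0ℓ

SatRel : Set → Set → Set₁
SatRel M L = M → Subset L → Set

W : {M L : Set} → SatRel M L → SatRel M L → Subset L → Subset L
W {M} ⊨₁ ⊨₂ Γ α = (m : M) → ⊨₁ m Γ → ⊨₂ m ｛ α ｝

StronglyGranularRel : {M L : Set} → SatRel M L → Set₁
StronglyGranularRel {M} {L} ⊨ =
  (m : M) (Γ : Subset L) →
    (⊨ m Γ → ∀ α → Γ α → ⊨ m ｛ α ｝) × ((∀ α → Γ α → ⊨ m ｛ α ｝) → ⊨ m Γ)

StronglyGranular : {M L : Set} → SatRel M L → SatRel M L → Set₁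
StronglyGranular ⊨₁ ⊨₂ = StronglyGranularRel ⊨₁ × StronglyGranularRel ⊨₂

RelIncl : {M L : Set} → SatRel M L → SatRel M L → Set₁
RelIncl {M} {L} ⊨₂ ⊨₁ = (m : M) (Γ : Subset L) → ⊨₂ m Γ → ⊨₁ m Γ

IsQConsequence : {L : Set} → (Subset L → Subset L) → Set₁
IsQConsequence {L} Op =
  ((Γ Σ : Subset L) → Γ ⊆ Σ → Op Γ ⊆ Op Σ)
  × ((Γ : Subset L) → Op (Op Γ ∪ Γ) ≐ Op Γ)

-- Under strong granularity, m ⊨₁ Γ is the conjunction of m ⊨₁ {β} over β ∈ Γ, so
-- enlarging Γ shrinks its ⊨₁-models and W is monotone. A ⊨₁-model m of Γ
-- satisfies every consequence α ∈ W(Γ) under ⊨₂, hence under ⊨₁ since ⊨₂ ⊆ ⊨₁;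
-- so m is also a ⊨₁-model of W(Γ) ∪ Γ, which gives W(W(Γ) ∪ Γ) ⊆ W(Γ). The
-- reverse inclusion is monotonicity, as Γ ⊆ W(Γ) ∪ Γ.
module Submission where

open import Defs
open import Data.Product using (_,_; proj₁; proj₂)
open import Data.Sum using ([_,_]; inj₂)
open import Relation.Unary using (_⊆_; _∪_)

module _ {M L : Set} where

  granular-antitone : {⊨ : SatRel M L} → StronglyGranularRel ⊨ →
    {Γ Σ : Subset L} → Γ ⊆ Σ → (m : M) → ⊨ m Σ → ⊨ m Γ
  granular-antitone granular {Γ} {Σ} Γ⊆Σ m mΣ =
    proj₂ (granular m Γ) (λ β β∈Γ → proj₁ (granular m Σ) mΣ β (Γ⊆Σ β∈Γ))

module _ {M L : Set} (⊨₁ ⊨₂ : SatRel M L) where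

  W-mono : StronglyGranularRel ⊨₁ →
    (Γ Σ : Subset L) → Γ ⊆ Σ → W ⊨₁ ⊨₂ Γ ⊆ W ⊨₁ ⊨₂ Σ
  W-mono granular₁ Γ Σ Γ⊆Σ α∈WΓ m mΣ =
    α∈WΓ m (granular-antitone granular₁ Γ⊆Σ m mΣ)

  models-W∪ : StronglyGranularRel ⊨₁ → RelIncl ⊨₂ ⊨₁ →
    (Γ : Subset L) (m : M) → ⊨₁ m Γ → ⊨₁ m (W ⊨₁ ⊨₂ Γ ∪ Γ)
  models-W∪ granular₁ ⊨₂⊆⊨₁ Γ m mΓ = proj₂ (granular₁ m _) (λ β →
    [ (λ β∈WΓ → ⊨₂⊆⊨₁ m _ (β∈WΓ m mΓ)) , proj₁ (granular₁ m Γ) mΓ β ])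

  W-absorb : StronglyGranularRel ⊨₁ → RelIncl ⊨₂ ⊨₁ →
    (Γ : Subset L) → W ⊨₁ ⊨₂ (W ⊨₁ ⊨₂ Γ ∪ Γ) ⊆ W ⊨₁ ⊨₂ Γ
  W-absorb granular₁ ⊨₂⊆⊨₁ Γ α∈W[WΓ∪Γ] m mΓ =
    α∈W[WΓ∪Γ] m (models-W∪ granular₁ ⊨₂⊆⊨₁ Γ m mΓ)

mainTheorem10 : (L M : Set) (⊨₁ ⊨₂ : SatRel M L) →
    StronglyGranular ⊨₁ ⊨₂ → RelIncl ⊨₂ ⊨₁ →
    IsQConsequence (W ⊨₁ ⊨₂)
mainTheorem10 L M ⊨₁ ⊨₂ (granular₁ , _) ⊨₂⊆⊨₁ =
  W-mono ⊨₁ ⊨₂ granular₁ ,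
  λ Γ → W-absorb ⊨₁ ⊨₂ granular₁ ⊨₂⊆⊨₁ Γ ,
        W-mono ⊨₁ ⊨₂ granular₁ Γ _ inj₂
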